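{- Let $G=(V,E)$ be a finite graph, $r\geq1$, and let $G'_r$ be constructed from $G$ and $r$ as in the context. Let $D$ be an effective divisor on $G'_r$ of rank $r$ with $\deg(D)=\operatorname{dgon}_r(G'_r)$. Then for each edge $e\in E$ with endpoints $v,u$, \[D(e_v)+D(e_u)\geq\begin{cases}2r & \text{if } v\sim_D u,\\ 2r-1 & \text{if } v\not\sim_D u.\end{cases}\]
   Context: Graphs are finite connected multigraphs without loops; divisors, effectiveness, equivalence via the Laplacian $L$ ($D'=D-L\sigma$, $\sigma\in\mathbb{Z}^{V}$), rank, and $\operatorname{dgon}_r$ (minimum degree of a rank $r$ divisor) are as in divisor theory on graphs. Construction of $G'_r$: let $M=r(3|V|+2|E|+1)+1$. $G'_r$ has a vertex $T$; for each $v\in V$ three vertices $v,v',T_v$; for each edge $e\in E$ with endpoints $u,v$ two vertices $e_u,e_v$. Edges: $M$ parallel edges between $T$ and each $T_v$; $M$ between each $v$ and $v'$; $r+2$ between each $v'$ and $T_v$; for each edge $e$ of $G$ with endpoints $u,v$, $M$ between $v$ and $e_v$, $M$ between $u$ and $e_u$, and $r$ between $e_u$ and $e_v$. For a divisor $D$, $x\sim_D y$ iff $\sigma(x)=\sigma(y)$ for every $\sigma\in\mathbb{Z}^{V(G'_r)}$ with $D-L\sigma\geq0$. -}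

module Defs where

open import Data.Nat as ℕ using (ℕ; zero; suc)
open import Data.Integer as ℤ using (ℤ; +_; 0ℤ)
open import Data.Fin using (Fin; _≟_)
open import Data.Bool using (Bool; true; false; if_then_else_)
open import Data.Product using (_×_; _,_; proj₁; proj₂; Σ; ∃)
open import Data.Sum using (_⊎_)
open import Data.List using (List; _∷_; []; map; _++_; foldr; allFin)
open import Relation.Nullary using (¬_; does)
open import Relation.Binary.PropositionalEquality using (_≡_; _≢_)

-- A finite multigraph G = (V, E): V = Fin n, E = Fin m, and each edge
-- e has an (ordered) pair of endpoints  ends e.  Parallel edges are
-- allowed (distinct e with the same endpoints).

record Graph : Set where
  field
    n    : ℕ
    m    : ℕ
    ends : Fin m → Fin n × Fin n
open Graph public

NoLoops : Graph → Set
NoLoops G = ∀ e → proj₁ (ends G e) ≢ proj₂ (ends G e)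

Adj : (G : Graph) → Fin (n G) → Fin (n G) → Set
Adj G v w = ∃ λ e → (ends G e ≡ (v , w)) ⊎ (ends G e ≡ (w , v))

data Walk (G : Graph) : Fin (n G) → Fin (n G) → Set where
  here : ∀ {u} → Walk G u u
  step : ∀ {u v w} → Walk G u v → Adj G v w → Walk G u w

Connected : Graph → Set
Connected G = ∀ u v → Walk G u v

endpoint : (G : Graph) → Fin (m G) → Bool → Fin (n G)
endpoint G e false = proj₁ (ends G e)
endpoint G e true  = proj₂ (ends G e)

-- The graph G'_r.  Vertices:  T;  v, v', T_v for v ∈ V;  e_u, e_v for
-- each edge e with endpoints u,v.  Here  ee e b  is e_{endpoint e b}.

data Vtx (G : Graph) : Set where
  T  : Vtx G
  vb : Fin (n G) → Vtx G
  vp : Fin (n G) → Vtx G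
  tv : Fin (n G) → Vtx G
  ee : Fin (m G) → Bool → Vtx G

allVtx : (G : Graph) → List (Vtx G)
allVtx G = T ∷ (map vb (allFin (n G)) ++ map vp (allFin (n G))
               ++ map tv (allFin (n G))
               ++ map (λ e → ee e false) (allFin (m G))
               ++ map (λ e → ee e true) (allFin (m G)))

bigM : Graph → ℕ → ℕ
bigM G r = r ℕ.* (3 ℕ.* n G ℕ.+ 2 ℕ.* m G ℕ.+ 1) ℕ.+ 1

ifEq : ∀ {k} → Fin k → Fin k → ℕ → ℕ
ifEq i j a = if does (i ≟ j) then a else 0

bneq : Bool → Bool → Bool
bneq false true = true
bneq true false = true
bneq _ _ = false

-- number of parallel edges between two vertices of G'_r
mult : (G : Graph) (r : ℕ) → Vtx G → Vtx G → ℕ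
mult G r T (tv _) = bigM G r
mult G r (tv _) T = bigM G r
mult G r (vb v) (vp w) = ifEq v w (bigM G r)
mult G r (vp v) (vb w) = ifEq v w (bigM G r)
mult G r (vp v) (tv w) = ifEq v w (r ℕ.+ 2)
mult G r (tv v) (vp w) = ifEq v w (r ℕ.+ 2)
mult G r (vb w) (ee e b) = ifEq (endpoint G e b) w (bigM G r)
mult G r (ee e b) (vb w) = ifEq (endpoint G e b) w (bigM G r)
mult G r (ee e b) (ee f c) = if bneq b c then ifEq e f r else 0
mult G r _ _ = 0

sumℤ : List ℤ → ℤ
sumℤ = foldr ℤ._+_ 0ℤ

Divisor : Graph → Set
Divisor G = Vtx G → ℤ

deg : ∀ {G} → Divisor G → ℤ
deg {G} D = sumℤ (map D (allVtx G))

Effective : ∀ {G} → Divisor G → Set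
Effective D = ∀ x → 0ℤ ℤ.≤ D x

Lap : (G : Graph) (r : ℕ) → (Vtx G → ℤ) → Divisor G
Lap G r σ x = sumℤ (map (λ y → + mult G r x y ℤ.* (σ x ℤ.- σ y)) (allVtx G))

fire : ∀ G r → Divisor G → (Vtx G → ℤ) → Divisor G
fire G r D σ x = D x ℤ.- Lap G r σ x

EquivEffective : ∀ G r → Divisor G → Set
EquivEffective G r D = ∃ λ σ → Effective (fire G r D σ)

RankAtLeast : ∀ G r → Divisor G → ℕ → Set
RankAtLeast G r D k = (E : Divisor G) → Effective E → deg E ≡ + k →
  EquivEffective G r (λ x → D x ℤ.- E x)

HasRank : ∀ G r → Divisor G → ℕ → Set
HasRank G r D k = RankAtLeast G r D k × ¬ RankAtLeast G r D (suc k)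

IsDgon : ∀ G r → Divisor G → Set
IsDgon G r D = HasRank G r D r × ((D' : Divisor G) → HasRank G r D' r → deg D ℤ.≤ deg D')

SimD : ∀ G r → Divisor G → Vtx G → Vtx G → Set
SimD G r D x y = (σ : Vtx G → ℤ) → Effective (fire G r D σ) → σ x ≡ σ y

-- The constant divisor r has rank r and
-- degree r·|V(G'_r)| < M, so deg D < M.  If D' − Lσ ≥ 0 for some D' bounded by an effective
-- divisor P of degree < M, then σ is constant across every M-fold edge: on the superlevel set
-- {σ ≥ σ(x)} the Laplacian sums to at most deg P, but a drop of σ across an M-fold edge leaving
-- that set alone contributes M.  So σ(e_u) = σ(u) and σ(e_v) = σ(v), and the Laplacian at e_u,
-- e_v only sees the r edges between them.  If D(e_u) < r, removing D(e_u)+1 chips from e_u and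
-- the other r − 1 − D(e_u) from e_v must be repaired by such a σ, which forces σ(e_v) > σ(e_u);
-- at e_v this costs r more chips, giving D(e_u) + D(e_v) ≥ 2r − 1, and σ (which also fires D
-- itself to an effective divisor) separates u and v.

module Submission where

open import Defs
open import Data.Bool using (Bool; true; false; not; _xor_; if_then_else_)
open import Data.Bool.Properties using (xor-same; xor-inverseˡ; not-involutive)
open import Data.Empty using (⊥-elim)
open import Data.Fin using (Fin; _≟_)
open import Data.Integer using (ℤ; +_; 0ℤ; 1ℤ; _+_; _*_; _-_; -_; _≤_; _<_; +≤+; +<+)
import Data.Integer.Properties as ℤP
open import Data.Integer.Tactic.RingSolver using (solve-∀)
open import Data.List using (List; []; _∷_; map; _++_; allFin; tabulate; length)
import Data.List.Properties as List
open import Data.List.Membership.Propositional using (_∈_)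
open import Data.List.Membership.Propositional.Properties using (∈-map⁺; ∈-++⁺ˡ; ∈-++⁺ʳ; ∈-allFin)
open import Data.List.Relation.Unary.Any using (here; there)
open import Data.Nat as ℕ using (ℕ; suc; z≤n; s≤s)
import Data.Nat.Properties as ℕP
import Data.Nat.Tactic.RingSolver as ℕSolver
open import Data.Product using (_×_; _,_; proj₁; proj₂)
open import Data.Sum using (_⊎_; inj₁; inj₂; [_,_]′)
open import Function using (_∘_)
open import Relation.Nullary using (¬_; does; yes; no)
open import Relation.Binary.PropositionalEquality

∑ : {A : Set} → List A → (A → ℤ) → ℤ
∑ xs f = sumℤ (map f xs)

≤-+-nonNeg : ∀ {a b c} → a ≤ b → 0ℤ ≤ c → a ≤ b + c
≤-+-nonNeg {a} a≤b c≥0 = subst (_≤ _) (ℤP.+-identityʳ a) (ℤP.+-mono-≤ a≤b c≥0)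

≤-nonNeg-+ : ∀ {a b c} → 0ℤ ≤ a → b ≤ c → b ≤ a + c
≤-nonNeg-+ {a} {b} {c} a≥0 b≤c = subst (b ≤_) (ℤP.+-comm c a) (≤-+-nonNeg b≤c a≥0)

minus-nonNeg-≤ : ∀ a {b} → 0ℤ ≤ b → a - b ≤ a
minus-nonNeg-≤ a {b} b≥0 = subst (a - b ≤_) (ℤP.+-identityʳ a) (ℤP.+-monoʳ-≤ a (ℤP.neg-mono-≤ b≥0))

module _ {A : Set} where

  ∑-cong : ∀ (xs : List A) {f g : A → ℤ} → (∀ x → f x ≡ g x) → ∑ xs f ≡ ∑ xs g
  ∑-cong []       f≗g = refl
  ∑-cong (x ∷ xs) f≗g = cong₂ _+_ (f≗g x) (∑-cong xs f≗g)

  ∑-zero : ∀ (xs : List A) {f : A → ℤ} → (∀ x → f x ≡ 0ℤ) → ∑ xs f ≡ 0ℤ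
  ∑-zero []       f≗0 = refl
  ∑-zero (x ∷ xs) f≗0 = cong₂ _+_ (f≗0 x) (∑-zero xs f≗0)

  ∑-const : ∀ (xs : List A) c → ∑ xs (λ _ → + c) ≡ + (length xs ℕ.* c)
  ∑-const []       c = refl
  ∑-const (x ∷ xs) c = cong (_+_ (+ c)) (∑-const xs c)

  ∑-distrib-+ : ∀ (xs : List A) (f g : A → ℤ) → ∑ xs (λ x → f x + g x) ≡ ∑ xs f + ∑ xs g
  ∑-distrib-+ []       f g = refl
  ∑-distrib-+ (x ∷ xs) f g =
    trans (cong (_+_ (f x + g x)) (∑-distrib-+ xs f g)) (medial (f x) (g x) (∑ xs f) (∑ xs g))
    where
    medial : ∀ a b c d → a + b + (c + d) ≡ a + c + (b + d)
    medial = solve-∀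

  ∑-distribˡ-* : ∀ (xs : List A) c (f : A → ℤ) → ∑ xs (λ x → c * f x) ≡ c * ∑ xs f
  ∑-distribˡ-* []       c f = sym (ℤP.*-zeroʳ c)
  ∑-distribˡ-* (x ∷ xs) c f =
    trans (cong (_+_ (c * f x)) (∑-distribˡ-* xs c f)) (sym (ℤP.*-distribˡ-+ c (f x) (∑ xs f)))

  ∑-++ : ∀ (xs ys : List A) (f : A → ℤ) → ∑ (xs ++ ys) f ≡ ∑ xs f + ∑ ys f
  ∑-++ []       ys f = sym (ℤP.+-identityˡ (∑ ys f))
  ∑-++ (x ∷ xs) ys f = trans (cong (_+_ (f x)) (∑-++ xs ys f)) (sym (ℤP.+-assoc (f x) _ _))

  ∑-mono-≤ : ∀ (xs : List A) {f g : A → ℤ} → (∀ x → f x ≤ g x) → ∑ xs f ≤ ∑ xs g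
  ∑-mono-≤ []       f≤g = ℤP.≤-refl
  ∑-mono-≤ (x ∷ xs) f≤g = ℤP.+-mono-≤ (f≤g x) (∑-mono-≤ xs f≤g)

  ∑-nonNeg : ∀ (xs : List A) {f : A → ℤ} → (∀ x → 0ℤ ≤ f x) → 0ℤ ≤ ∑ xs f
  ∑-nonNeg []       f≥0 = ℤP.≤-refl
  ∑-nonNeg (x ∷ xs) f≥0 = ℤP.+-mono-≤ (f≥0 x) (∑-nonNeg xs f≥0)

  term≤∑ : ∀ {xs : List A} {f : A → ℤ} → (∀ x → 0ℤ ≤ f x) → ∀ {x} → x ∈ xs → f x ≤ ∑ xs f
  term≤∑ {_ ∷ xs} f≥0 (here refl) = ≤-+-nonNeg ℤP.≤-refl (∑-nonNeg xs f≥0)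
  term≤∑ {y ∷ _}  f≥0 (there x∈) = ≤-nonNeg-+ (f≥0 y) (term≤∑ f≥0 x∈)

  pair≤∑ : ∀ {xs : List A} {f : A → ℤ} → (∀ x → 0ℤ ≤ f x) →
           ∀ {x y} → x ∈ xs → y ∈ xs → x ≢ y → f x + f y ≤ ∑ xs f
  pair≤∑ f≥0 (here refl) (here refl) x≢y = ⊥-elim (x≢y refl)
  pair≤∑ {f = f} f≥0 {x} (here refl) (there y∈) _ = ℤP.+-monoʳ-≤ (f x) (term≤∑ f≥0 y∈)
  pair≤∑ {f = f} f≥0 {x} {y} (there x∈) (here refl) _ =
    subst (_≤ _) (ℤP.+-comm (f y) (f x)) (ℤP.+-monoʳ-≤ (f y) (term≤∑ f≥0 x∈))
  pair≤∑ {z ∷ _} f≥0 (there x∈) (there y∈) x≢y = ≤-nonNeg-+ (f≥0 z) (pair≤∑ f≥0 x∈ y∈ x≢y)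

∑-map : ∀ {A B : Set} (g : A → B) (xs : List A) (f : B → ℤ) → ∑ (map g xs) f ≡ ∑ xs (f ∘ g)
∑-map g xs f = cong sumℤ (sym (List.map-∘ xs))

∑-comm : ∀ {A B : Set} (xs : List A) (ys : List B) (F : A → B → ℤ) →
         ∑ xs (λ x → ∑ ys (F x)) ≡ ∑ ys (λ y → ∑ xs (λ x → F x y))
∑-comm []       ys F = sym (∑-zero ys (λ _ → refl))
∑-comm (x ∷ xs) ys F =
  trans (cong (_+_ (∑ ys (F x))) (∑-comm xs ys F)) (sym (∑-distrib-+ ys (F x) _))

∑-allFin-if : ∀ {k} (i : Fin k) (h : Fin k → ℤ) →
              ∑ (allFin k) (λ j → if does (i ≟ j) then h j else 0ℤ) ≡ h i
∑-allFin-if {k} i h = trans (cong sumℤ (List.map-tabulate {n = k} (λ j → j) _)) (sum-tabulate i h)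
  where
  sum-tabulate : ∀ {k} (i : Fin k) (h : Fin k → ℤ) →
                 sumℤ (tabulate (λ j → if does (i ≟ j) then h j else 0ℤ)) ≡ h i
  sum-tabulate {suc k} Fin.zero h =
    trans (cong (_+_ (h Fin.zero)) (trans (cong sumℤ (sym (List.map-tabulate {n = k} (λ j → j) (λ _ → 0ℤ))))
                                       (∑-zero (allFin k) (λ _ → refl))))
          (ℤP.+-identityʳ (h Fin.zero))
  sum-tabulate {suc k} (Fin.suc i) h = trans (ℤP.+-identityˡ _) (sum-tabulate i (h ∘ Fin.suc))

∑-allFin-ifEq : ∀ {k} (i : Fin k) c (h : Fin k → ℤ) →
                ∑ (allFin k) (λ j → + ifEq i j c * h j) ≡ + c * h i
∑-allFin-ifEq i c h = trans (∑-cong (allFin _) ifEq-*) (∑-allFin-if i (λ j → + c * h j))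
  where
  ifEq-* : ∀ j → + ifEq i j c * h j ≡ (if does (i ≟ j) then + c * h j else 0ℤ)
  ifEq-* j with does (i ≟ j)
  ... | true  = refl
  ... | false = refl

sum-over-Bool : ∀ (h : Bool → ℤ) b → h false + h true ≡ h b + h (not b)
sum-over-Bool h false = refl
sum-over-Bool h true  = ℤP.+-comm (h false) (h true)

*-difference-zero : ∀ c {a b} → a ≡ b → c * (a - b) ≡ 0ℤ
*-difference-zero c {a} refl = trans (cong (c *_) (ℤP.+-inverseʳ a)) (ℤP.*-zeroʳ c)

+[2*r]≡r+r : ∀ r → + (2 ℕ.* r) ≡ + r + + r
+[2*r]≡r+r r = cong (λ k → + (r ℕ.+ k)) (ℕP.+-identityʳ r)

ifEq-refl : ∀ {k} (i : Fin k) a → ifEq i i a ≡ a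
ifEq-refl i a with i ≟ i
... | yes _  = refl
... | no i≢i = ⊥-elim (i≢i refl)

ifEq-sym : ∀ {k} (i j : Fin k) a → ifEq i j a ≡ ifEq j i a
ifEq-sym i j a with i ≟ j | j ≟ i
... | yes _   | yes _   = refl
... | no _    | no _    = refl
... | yes i≡j | no j≢i  = ⊥-elim (j≢i (sym i≡j))
... | no i≢j  | yes j≡i = ⊥-elim (i≢j (sym j≡i))

bneq-sym : ∀ b c → bneq b c ≡ bneq c b
bneq-sym false false = refl
bneq-sym false true  = refl
bneq-sym true  false = refl
bneq-sym true  true  = refl

bneq-irrefl : ∀ b → bneq b b ≡ false
bneq-irrefl false = refl
bneq-irrefl true  = refl

bneq-not : ∀ b → bneq b (not b) ≡ true
bneq-not false = refl
bneq-not true  = refl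

module _ (G : Graph) where

  private
    Vs : List (Fin (n G))
    Vs = allFin (n G)
    Es : List (Fin (m G))
    Es = allFin (m G)

  ∑-allVtx : ∀ (g : Vtx G → ℤ) →
             ∑ (allVtx G) g ≡
               g T + (∑ (allFin (n G)) (g ∘ vb) + (∑ (allFin (n G)) (g ∘ vp) + (∑ (allFin (n G)) (g ∘ tv) +
                 (∑ (allFin (m G)) (λ f → g (ee f false)) + ∑ (allFin (m G)) (λ f → g (ee f true))))))
  ∑-allVtx g = cong (_+_ (g T))
    (trans (∑-++ (map vb Vs) _ g) (cong₂ _+_ (∑-map vb Vs g)
    (trans (∑-++ (map vp Vs) _ g) (cong₂ _+_ (∑-map vp Vs g)
    (trans (∑-++ (map tv Vs) _ g) (cong₂ _+_ (∑-map tv Vs g)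
    (trans (∑-++ (map (λ f → ee f false) Es) _ g) (cong₂ _+_ (∑-map _ Es g) (∑-map _ Es g)))))))))

  ∑-allVtx-edgeVertices : ∀ (g : Vtx G → ℤ) → g T ≡ 0ℤ →
    (∀ w → g (vb w) ≡ 0ℤ) → (∀ w → g (vp w) ≡ 0ℤ) → (∀ w → g (tv w) ≡ 0ℤ) →
    ∑ (allVtx G) g ≡ ∑ (allFin (m G)) (λ f → g (ee f false)) + ∑ (allFin (m G)) (λ f → g (ee f true))
  ∑-allVtx-edgeVertices g gT≡0 vb≡0 vp≡0 tv≡0 = begin
    ∑ (allVtx G) g
      ≡⟨ ∑-allVtx g ⟩
    g T + (∑ Vs (g ∘ vb) + (∑ Vs (g ∘ vp) + (∑ Vs (g ∘ tv) + edges)))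
      ≡⟨ cong₂ _+_ gT≡0 (cong₂ _+_ (∑-zero Vs vb≡0) (cong₂ _+_ (∑-zero Vs vp≡0) (cong₂ _+_ (∑-zero Vs tv≡0) refl))) ⟩
    0ℤ + (0ℤ + (0ℤ + (0ℤ + edges)))
      ≡⟨ zeros+ edges ⟩
    edges ∎
    where
    open ≡-Reasoning
    edges : ℤ
    edges = ∑ Es (λ f → g (ee f false)) + ∑ Es (λ f → g (ee f true))
    zeros+ : ∀ a → 0ℤ + (0ℤ + (0ℤ + (0ℤ + a))) ≡ a
    zeros+ = solve-∀

  ∈-allVtx : ∀ x → x ∈ allVtx G
  ∈-allVtx T            = here refl
  ∈-allVtx (vb w)       = there (∈-++⁺ˡ (∈-map⁺ vb (∈-allFin w)))
  ∈-allVtx (vp w)       = there (∈-++⁺ʳ (map vb Vs) (∈-++⁺ˡ (∈-map⁺ vp (∈-allFin w))))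
  ∈-allVtx (tv w)       = there (∈-++⁺ʳ (map vb Vs) (∈-++⁺ʳ (map vp Vs) (∈-++⁺ˡ (∈-map⁺ tv (∈-allFin w)))))
  ∈-allVtx (ee f false) = there (∈-++⁺ʳ (map vb Vs) (∈-++⁺ʳ (map vp Vs) (∈-++⁺ʳ (map tv Vs)
                            (∈-++⁺ˡ (∈-map⁺ (λ e → ee e false) (∈-allFin f))))))
  ∈-allVtx (ee f true)  = there (∈-++⁺ʳ (map vb Vs) (∈-++⁺ʳ (map vp Vs) (∈-++⁺ʳ (map tv Vs)
                            (∈-++⁺ʳ (map (λ e → ee e false) Es) (∈-map⁺ (λ e → ee e true) (∈-allFin f))))))

  ≤-deg : (E : Divisor G) → Effective E → ∀ x → E x ≤ deg E
  ≤-deg E E≥0 x = term≤∑ E≥0 (∈-allVtx x)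

  deg-constant : ∀ c → deg {G} (λ _ → + c) ≡ + ((3 ℕ.* n G ℕ.+ 2 ℕ.* m G ℕ.+ 1) ℕ.* c)
  deg-constant c = begin
    deg {G} (λ _ → + c)
      ≡⟨ ∑-allVtx (λ _ → + c) ⟩
    + c + (∑ Vs (λ _ → + c) + (∑ Vs (λ _ → + c) + (∑ Vs (λ _ → + c) + (∑ Es (λ _ → + c) + ∑ Es (λ _ → + c)))))
      ≡⟨ cong (_+_ (+ c)) (cong₂ _+_ (block (n G)) (cong₂ _+_ (block (n G)) (cong₂ _+_ (block (n G)) (cong₂ _+_ (block (m G)) (block (m G)))))) ⟩
    + (c ℕ.+ (n G ℕ.* c ℕ.+ (n G ℕ.* c ℕ.+ (n G ℕ.* c ℕ.+ (m G ℕ.* c ℕ.+ m G ℕ.* c)))))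
      ≡⟨ cong +_ (count (n G) (m G) c) ⟩
    + ((3 ℕ.* n G ℕ.+ 2 ℕ.* m G ℕ.+ 1) ℕ.* c) ∎
    where
    open ≡-Reasoning
    block : ∀ k → ∑ (allFin k) (λ _ → + c) ≡ + (k ℕ.* c)
    block k = trans (∑-const (allFin k) c) (cong (λ l → + (l ℕ.* c)) (List.length-tabulate {n = k} (λ j → j)))
    count : ∀ a b c → c ℕ.+ (a ℕ.* c ℕ.+ (a ℕ.* c ℕ.+ (a ℕ.* c ℕ.+ (b ℕ.* c ℕ.+ b ℕ.* c)))) ≡ (3 ℕ.* a ℕ.+ 2 ℕ.* b ℕ.+ 1) ℕ.* c
    count = ℕSolver.solve-∀

  edgeDivisor : Fin (m G) → (Bool → ℤ) → Divisor G
  edgeDivisor e h (ee f c) = if does (e ≟ f) then h c else 0ℤ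
  edgeDivisor e h _        = 0ℤ

  edgeDivisor-at : ∀ e h c → edgeDivisor e h (ee e c) ≡ h c
  edgeDivisor-at e h c with e ≟ e
  ... | yes _  = refl
  ... | no e≢e = ⊥-elim (e≢e refl)

  edgeDivisor-effective : ∀ e {h} → (∀ c → 0ℤ ≤ h c) → Effective (edgeDivisor e h)
  edgeDivisor-effective e h≥0 (ee f c) with does (e ≟ f)
  ... | true  = h≥0 c
  ... | false = ℤP.≤-refl
  edgeDivisor-effective e h≥0 T      = ℤP.≤-refl
  edgeDivisor-effective e h≥0 (vb _) = ℤP.≤-refl
  edgeDivisor-effective e h≥0 (vp _) = ℤP.≤-refl
  edgeDivisor-effective e h≥0 (tv _) = ℤP.≤-refl

  deg-edgeDivisor : ∀ e h → deg (edgeDivisor e h) ≡ h false + h true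
  deg-edgeDivisor e h =
    trans (∑-allVtx-edgeVertices (edgeDivisor e h) refl (λ _ → refl) (λ _ → refl) (λ _ → refl))
          (cong₂ _+_ (∑-allFin-if e (λ _ → h false)) (∑-allFin-if e (λ _ → h true)))

module _ (G : Graph) (r : ℕ) where

  mult-sym : ∀ x y → mult G r x y ≡ mult G r y x
  mult-sym T        T        = refl
  mult-sym T        (vb _)   = refl
  mult-sym T        (vp _)   = refl
  mult-sym T        (tv _)   = refl
  mult-sym T        (ee _ _) = refl
  mult-sym (vb _)   T        = refl
  mult-sym (vb _)   (vb _)   = refl
  mult-sym (vb v)   (vp w)   = ifEq-sym v w _
  mult-sym (vb _)   (tv _)   = refl
  mult-sym (vb _)   (ee _ _) = refl
  mult-sym (vp _)   T        = refl
  mult-sym (vp v)   (vb w)   = ifEq-sym v w _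
  mult-sym (vp _)   (vp _)   = refl
  mult-sym (vp v)   (tv w)   = ifEq-sym v w _
  mult-sym (vp _)   (ee _ _) = refl
  mult-sym (tv _)   T        = refl
  mult-sym (tv _)   (vb _)   = refl
  mult-sym (tv v)   (vp w)   = ifEq-sym v w _
  mult-sym (tv _)   (tv _)   = refl
  mult-sym (tv _)   (ee _ _) = refl
  mult-sym (ee _ _) T        = refl
  mult-sym (ee _ _) (vb _)   = refl
  mult-sym (ee _ _) (vp _)   = refl
  mult-sym (ee _ _) (tv _)   = refl
  mult-sym (ee e b) (ee f c) rewrite bneq-sym b c | ifEq-sym e f r = refl

  Heavy : Vtx G → Vtx G → Set
  Heavy x y = bigM G r ℕ.≤ mult G r x y

  heavy-sym : ∀ {x y} → Heavy x y → Heavy y x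
  heavy-sym {x} {y} = subst (bigM G r ℕ.≤_) (mult-sym x y)

  heavy-T-tv : ∀ w → Heavy T (tv w)
  heavy-T-tv w = ℕP.≤-refl

  heavy-ee-vb : ∀ e c → Heavy (ee e c) (vb (endpoint G e c))
  heavy-ee-vb e c = ℕP.≤-reflexive (sym (ifEq-refl (endpoint G e c) (bigM G r)))

  Lap-vanishes : ∀ σ x → (∀ y → mult G r x y ≡ 0 ⊎ σ x ≡ σ y) → Lap G r σ x ≡ 0ℤ
  Lap-vanishes σ x flat = ∑-zero (allVtx G) λ y →
    [ (λ mult≡0 → cong (λ k → + k * (σ x - σ y)) mult≡0) , *-difference-zero (+ mult G r x y) ]′ (flat y)

  Lap-edgeVertex : ∀ σ e b → σ (ee e b) ≡ σ (vb (endpoint G e b)) →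
                   Lap G r σ (ee e b) ≡ + r * (σ (ee e b) - σ (ee e (not b)))
  Lap-edgeVertex σ e b flat = begin
    Lap G r σ (ee e b)
      ≡⟨ ∑-allVtx-edgeVertices G term refl across-heavy (λ _ → refl) (λ _ → refl) ⟩
    side false + side true
      ≡⟨ sum-over-Bool side b ⟩
    side b + side (not b)
      ≡⟨ cong₂ _+_ same-side other-side ⟩
    0ℤ + + r * (σ (ee e b) - σ (ee e (not b)))
      ≡⟨ ℤP.+-identityˡ _ ⟩
    + r * (σ (ee e b) - σ (ee e (not b))) ∎
    where
    open ≡-Reasoning
    term : Vtx G → ℤ
    term y = + mult G r (ee e b) y * (σ (ee e b) - σ y)
    side : Bool → ℤ
    side c = ∑ (allFin (m G)) (λ f → term (ee f c))
    across-heavy : ∀ w → term (vb w) ≡ 0ℤ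
    across-heavy w with endpoint G e b ≟ w
    ... | yes refl = *-difference-zero (+ bigM G r) flat
    ... | no _     = refl
    same-side : side b ≡ 0ℤ
    same-side = ∑-zero (allFin (m G)) λ f →
      cong (λ β → + (if β then ifEq e f r else 0) * (σ (ee e b) - σ (ee f b))) (bneq-irrefl b)
    other-side : side (not b) ≡ + r * (σ (ee e b) - σ (ee e (not b)))
    other-side = trans
      (∑-cong (allFin (m G)) λ f →
        cong (λ β → + (if β then ifEq e f r else 0) * (σ (ee e b) - σ (ee f (not b)))) (bneq-not b))
      (∑-allFin-ifEq e r (λ f → σ (ee e b) - σ (ee f (not b))))

  dirichletTerm : (τ σ : Vtx G → ℤ) → Vtx G → Vtx G → ℤ
  dirichletTerm τ σ z w = + mult G r z w * ((τ z - τ w) * (σ z - σ w))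

  dirichletTerm-sym : ∀ τ σ z w → dirichletTerm τ σ z w ≡ dirichletTerm τ σ w z
  dirichletTerm-sym τ σ z w rewrite mult-sym z w = flip (+ mult G r w z) (τ z) (τ w) (σ z) (σ w)
    where
    flip : ∀ c a b s t → c * ((a - b) * (s - t)) ≡ c * ((b - a) * (t - s))
    flip = solve-∀

  Lap-summation-by-parts : ∀ (τ σ : Vtx G → ℤ) →
    ∑ (allVtx G) (λ z → τ z * Lap G r σ z) + ∑ (allVtx G) (λ z → τ z * Lap G r σ z) ≡
    ∑ (allVtx G) (λ z → ∑ (allVtx G) (dirichletTerm τ σ z))
  Lap-summation-by-parts τ σ = begin
    S + S
      ≡⟨ cong₂ _+_ S≡∑∑A (trans S≡∑∑A (∑-comm V V A)) ⟩
    ∑ V (λ z → ∑ V (A z)) + ∑ V (λ z → ∑ V (λ w → A w z))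
      ≡⟨ sym (∑-distrib-+ V (λ z → ∑ V (A z)) (λ z → ∑ V (λ w → A w z))) ⟩
    ∑ V (λ z → ∑ V (A z) + ∑ V (λ w → A w z))
      ≡⟨ ∑-cong V (λ z → sym (∑-distrib-+ V (A z) (λ w → A w z))) ⟩
    ∑ V (λ z → ∑ V (λ w → A z w + A w z))
      ≡⟨ ∑-cong V (λ z → ∑-cong V (symmetrise z)) ⟩
    ∑ V (λ z → ∑ V (dirichletTerm τ σ z)) ∎
    where
    open ≡-Reasoning
    V : List (Vtx G)
    V = allVtx G
    S : ℤ
    S = ∑ V (λ z → τ z * Lap G r σ z)
    A : Vtx G → Vtx G → ℤ
    A z w = τ z * (+ mult G r z w * (σ z - σ w))
    S≡∑∑A : S ≡ ∑ V (λ z → ∑ V (A z))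
    S≡∑∑A = ∑-cong V (λ z → sym (∑-distribˡ-* V (τ z) (λ w → + mult G r z w * (σ z - σ w))))
    identity : ∀ a b c s t → a * (c * (s - t)) + b * (c * (t - s)) ≡ c * ((a - b) * (s - t))
    identity = solve-∀
    symmetrise : ∀ z w → A z w + A w z ≡ dirichletTerm τ σ z w
    symmetrise z w rewrite mult-sym w z = identity (τ z) (τ w) (+ mult G r z w) (σ z) (σ w)

  above : ℤ → ℤ → ℤ
  above t s = if does (t ℤP.≤? s) then 1ℤ else 0ℤ

  above-refl : ∀ t → above t t ≡ 1ℤ
  above-refl t with t ℤP.≤? t
  ... | yes _  = refl
  ... | no t≰t = ⊥-elim (t≰t ℤP.≤-refl)

  above-< : ∀ {t s} → s < t → above t s ≡ 0ℤ
  above-< {t} {s} s<t with t ℤP.≤? s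
  ... | yes t≤s = ⊥-elim (ℤP.<⇒≱ s<t t≤s)
  ... | no _    = refl

  above-*-≤ : ∀ t s {a b} → a ≤ b → 0ℤ ≤ b → above t s * a ≤ b
  above-*-≤ t s {a} a≤b b≥0 with t ℤP.≤? s
  ... | yes _ = subst (_≤ _) (sym (ℤP.*-identityˡ a)) a≤b
  ... | no _  = b≥0

  above-monotone : ∀ t a b → 0ℤ ≤ (above t a - above t b) * (a - b)
  above-monotone t a b with t ℤP.≤? a | t ℤP.≤? b
  ... | yes _   | yes _   = ℤP.≤-refl
  ... | no _    | no _    = ℤP.≤-refl
  ... | yes t≤a | no t≰b  =
    subst (0ℤ ≤_) (sym (ℤP.*-identityˡ (a - b))) (ℤP.i≤j⇒0≤j-i (ℤP.≤-trans (ℤP.<⇒≤ (ℤP.≰⇒> t≰b)) t≤a))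
  ... | no t≰a  | yes t≤b =
    subst (0ℤ ≤_) (negate a b) (ℤP.i≤j⇒0≤j-i (ℤP.≤-trans (ℤP.<⇒≤ (ℤP.≰⇒> t≰a)) t≤b))
    where
    negate : ∀ a b → b - a ≡ (0ℤ - 1ℤ) * (a - b)
    negate = solve-∀

  dirichletTerm-above-nonNeg : ∀ t σ z w → 0ℤ ≤ dirichletTerm (above t ∘ σ) σ z w
  dirichletTerm-above-nonNeg t σ z w = subst (_≤ dirichletTerm (above t ∘ σ) σ z w) (ℤP.*-zeroʳ (+ mult G r z w))
    (ℤP.*-monoˡ-≤-nonNeg (+ mult G r z w) (above-monotone t (σ z) (σ w)))

  bigM≤dirichletTerm-above : ∀ σ {x y} → Heavy x y → σ y < σ x →
    + bigM G r ≤ dirichletTerm (above (σ x) ∘ σ) σ x y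
  bigM≤dirichletTerm-above σ {x} {y} heavy σy<σx = begin
    + bigM G r                    ≤⟨ +≤+ heavy ⟩
    + mult G r x y                ≡⟨ sym (ℤP.*-identityʳ _) ⟩
    + mult G r x y * 1ℤ           ≤⟨ ℤP.*-monoˡ-≤-nonNeg (+ mult G r x y) gap ⟩
    + mult G r x y * (σ x - σ y)  ≡⟨ cong (λ d → + mult G r x y * d) (sym jump) ⟩
    dirichletTerm (above (σ x) ∘ σ) σ x y ∎
    where
    open ℤP.≤-Reasoning
    shift : ∀ a b → a - (1ℤ + b) ≡ (a - b) - 1ℤ
    shift = solve-∀
    gap : 1ℤ ≤ σ x - σ y
    gap = ℤP.0≤i-j⇒j≤i (subst (0ℤ ≤_) (shift (σ x) (σ y)) (ℤP.i≤j⇒0≤j-i (ℤP.i<j⇒suc[i]≤j σy<σx)))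
    jump : (above (σ x) (σ x) - above (σ x) (σ y)) * (σ x - σ y) ≡ σ x - σ y
    jump = trans (cong (_* (σ x - σ y)) (cong₂ _-_ (above-refl (σ x)) (above-< σy<σx)))
                 (ℤP.*-identityˡ (σ x - σ y))

  superlevel-Lap≤deg : (P : Divisor G) → Effective P → ∀ σ → (∀ z → Lap G r σ z ≤ P z) →
    ∀ t → ∑ (allVtx G) (λ z → above t (σ z) * Lap G r σ z) ≤ deg P
  superlevel-Lap≤deg P P≥0 σ Lap≤P t = ∑-mono-≤ (allVtx G) (λ z → above-*-≤ t (σ z) (Lap≤P z) (P≥0 z))

  -- Across an M-fold edge from x down to y the summation by parts sees at least 2M, while
  -- the bound by deg P gives strictly less.
  no-drop-across-heavy : (P : Divisor G) → Effective P → deg P < + bigM G r →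
    (σ : Vtx G → ℤ) → (∀ z → Lap G r σ z ≤ P z) → ∀ {x y} → Heavy x y → ¬ σ y < σ x
  no-drop-across-heavy P P≥0 degP<M σ Lap≤P {x} {y} heavy σy<σx =
    ℤP.<-irrefl refl (ℤP.<-≤-trans (ℤP.+-mono-< S<M S<M) 2M≤2S)
    where
    V : List (Vtx G)
    V = allVtx G
    M : ℤ
    M = + bigM G r
    τ : Vtx G → ℤ
    τ = above (σ x) ∘ σ
    S : ℤ
    S = ∑ V (λ z → τ z * Lap G r σ z)
    S<M : S < M
    S<M = ℤP.≤-<-trans (superlevel-Lap≤deg P P≥0 σ Lap≤P (σ x)) degP<M
    H≥0 : ∀ z w → 0ℤ ≤ dirichletTerm τ σ z w
    H≥0 = dirichletTerm-above-nonNeg (σ x) σ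
    x≢y : x ≢ y
    x≢y x≡y = ℤP.<-irrefl (cong σ (sym x≡y)) σy<σx
    M≤Hxy : M ≤ dirichletTerm τ σ x y
    M≤Hxy = bigM≤dirichletTerm-above σ heavy σy<σx
    2M≤2S : M + M ≤ S + S
    2M≤2S = begin
      M + M
        ≤⟨ ℤP.+-mono-≤ M≤Hxy (subst (M ≤_) (dirichletTerm-sym τ σ x y) M≤Hxy) ⟩
      dirichletTerm τ σ x y + dirichletTerm τ σ y x
        ≤⟨ ℤP.+-mono-≤ (term≤∑ (H≥0 x) (∈-allVtx G y)) (term≤∑ (H≥0 y) (∈-allVtx G x)) ⟩
      ∑ V (dirichletTerm τ σ x) + ∑ V (dirichletTerm τ σ y)
        ≤⟨ pair≤∑ (λ z → ∑-nonNeg V (H≥0 z)) (∈-allVtx G x) (∈-allVtx G y) x≢y ⟩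
      ∑ V (λ z → ∑ V (dirichletTerm τ σ z))
        ≡⟨ sym (Lap-summation-by-parts τ σ) ⟩
      S + S ∎
      where open ℤP.≤-Reasoning

  flat-across-heavy : (P : Divisor G) → Effective P → deg P < + bigM G r →
    (σ : Vtx G → ℤ) → (∀ z → Lap G r σ z ≤ P z) → ∀ {x y} → Heavy x y → σ x ≡ σ y
  flat-across-heavy P P≥0 degP<M σ Lap≤P {x} {y} heavy = ℤP.≤-antisym
    (ℤP.≮⇒≥ (no-drop-across-heavy P P≥0 degP<M σ Lap≤P heavy))
    (ℤP.≮⇒≥ (no-drop-across-heavy P P≥0 degP<M σ Lap≤P (heavy-sym {x} {y} heavy)))

  Lap≤-of-firing : ∀ {D E : Divisor G} σ → Effective E →
    Effective (fire G r (λ z → D z - E z) σ) → ∀ z → Lap G r σ z ≤ D z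
  Lap≤-of-firing {D} {E} σ E≥0 fired≥0 z =
    ℤP.≤-trans (ℤP.0≤i-j⇒j≤i (fired≥0 z)) (minus-nonNeg-≤ (D z) (E≥0 z))

  firing-of-difference : ∀ {D E : Divisor G} σ → Effective E →
    Effective (fire G r (λ z → D z - E z) σ) → Effective (fire G r D σ)
  firing-of-difference {D} {E} σ E≥0 fired≥0 z =
    ℤP.≤-trans (fired≥0 z) (ℤP.+-monoˡ-≤ (- Lap G r σ z) (minus-nonNeg-≤ (D z) (E≥0 z)))

  deg-constant<bigM : deg {G} (λ _ → + r) < + bigM G r
  deg-constant<bigM = subst (_< + bigM G r) (sym (deg-constant G r))
    (+<+ (subst (ℕ._< bigM G r) (ℕP.*-comm r _) (ℕP.m<m+n _ (s≤s z≤n))))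

  constant-rank≥ : RankAtLeast G r (λ _ → + r) r
  constant-rank≥ E E≥0 degE≡r = (λ _ → 0ℤ) , λ x →
    subst (0ℤ ≤_)
      (sym (trans (cong (_-_ (+ r - E x)) (Lap-vanishes (λ _ → 0ℤ) x (λ _ → inj₂ refl))) (ℤP.+-identityʳ _)))
      (ℤP.i≤j⇒0≤j-i (subst (E x ≤_) degE≡r (≤-deg G E E≥0 x)))

  constant-rank≱ : ¬ RankAtLeast G r (λ _ → + r) (suc r)
  constant-rank≱ rank≥r+1 = 0≰-1 (subst (0ℤ ≤_) chips-at-T (fired≥0 T))
    where
    E : Divisor G
    E T = + suc r
    E _ = 0ℤ
    E≥0 : Effective E
    E≥0 T        = +≤+ z≤n
    E≥0 (vb _)   = ℤP.≤-refl
    E≥0 (vp _)   = ℤP.≤-refl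
    E≥0 (tv _)   = ℤP.≤-refl
    E≥0 (ee _ _) = ℤP.≤-refl
    deg-E : deg E ≡ + suc r
    deg-E = trans (∑-allVtx G E) (trans
      (cong (_+_ (+ suc r)) (cong₂ _+_ (zeros (n G)) (cong₂ _+_ (zeros (n G)) (cong₂ _+_ (zeros (n G))
        (cong₂ _+_ (zeros (m G)) (zeros (m G)))))))
      (ℤP.+-identityʳ (+ suc r)))
      where
      zeros : ∀ k → ∑ (allFin k) (λ _ → 0ℤ) ≡ 0ℤ
      zeros k = ∑-zero (allFin k) (λ _ → refl)
    σ : Vtx G → ℤ
    σ = proj₁ (rank≥r+1 E E≥0 deg-E)
    fired≥0 : Effective (fire G r (λ z → + r - E z) σ)
    fired≥0 = proj₂ (rank≥r+1 E E≥0 deg-E)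
    flat : ∀ w → σ T ≡ σ (tv w)
    flat w = flat-across-heavy (λ _ → + r) (λ _ → +≤+ z≤n) deg-constant<bigM σ
               (Lap≤-of-firing σ E≥0 fired≥0) (heavy-T-tv w)
    Lap-T : Lap G r σ T ≡ 0ℤ
    Lap-T = Lap-vanishes σ T λ where
      (tv w)   → inj₂ (flat w)
      T        → inj₁ refl
      (vb _)   → inj₁ refl
      (vp _)   → inj₁ refl
      (ee _ _) → inj₁ refl
    chips-at-T : (+ r - E T) - Lap G r σ T ≡ - 1ℤ
    chips-at-T = trans (cong (_-_ (+ r - E T)) Lap-T) (identity (+ r))
      where
      identity : ∀ R → (R - (1ℤ + R)) - 0ℤ ≡ - 1ℤ
      identity = solve-∀
    0≰-1 : ¬ 0ℤ ≤ - 1ℤ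
    0≰-1 ()

  dgon<bigM : ∀ D → IsDgon G r D → deg D < + bigM G r
  dgon<bigM D (_ , minimal) = ℤP.≤-<-trans (minimal (λ _ → + r) (constant-rank≥ , constant-rank≱)) deg-constant<bigM

  module ShortEdge (D : Divisor G) (D≥0 : Effective D) (degD<M : deg D < + bigM G r)
                   (rank≥r : RankAtLeast G r D r) (e : Fin (m G)) (b : Bool)
                   (short : D (ee e b) < + r) where

    x y : Vtx G
    x = ee e b
    y = ee e (not b)

    removed : Bool → ℤ
    removed c = if c xor b then + r - (1ℤ + D x) else 1ℤ + D x

    E : Divisor G
    E = edgeDivisor G e removed

    removed-x : removed b ≡ 1ℤ + D x
    removed-x rewrite xor-same b = refl

    removed-y : removed (not b) ≡ + r - (1ℤ + D x)
    removed-y rewrite xor-inverseˡ b = refl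

    E-x : E x ≡ 1ℤ + D x
    E-x = trans (edgeDivisor-at G e removed b) removed-x

    E-y : E y ≡ + r - (1ℤ + D x)
    E-y = trans (edgeDivisor-at G e removed (not b)) removed-y

    E≥0 : Effective E
    E≥0 = edgeDivisor-effective G e removed≥0
      where
      removed≥0 : ∀ c → 0ℤ ≤ removed c
      removed≥0 c with c xor b
      ... | true  = ℤP.i≤j⇒0≤j-i (ℤP.i<j⇒suc[i]≤j short)
      ... | false = ℤP.≤-trans (D≥0 x) (ℤP.i≤j⇒i≤k+j 1ℤ ℤP.≤-refl)

    deg-E : deg E ≡ + r
    deg-E = begin
      deg E                                  ≡⟨ deg-edgeDivisor G e removed ⟩
      removed false + removed true           ≡⟨ sum-over-Bool removed b ⟩
      removed b + removed (not b)            ≡⟨ cong₂ _+_ removed-x removed-y ⟩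
      (1ℤ + D x) + (+ r - (1ℤ + D x))        ≡⟨ identity (D x) (+ r) ⟩
      + r ∎
      where
      open ≡-Reasoning
      identity : ∀ a R → (1ℤ + a) + (R - (1ℤ + a)) ≡ R
      identity = solve-∀

    σ : Vtx G → ℤ
    σ = proj₁ (rank≥r E E≥0 deg-E)

    fired≥0 : Effective (fire G r (λ z → D z - E z) σ)
    fired≥0 = proj₂ (rank≥r E E≥0 deg-E)

    σ-effective : Effective (fire G r D σ)
    σ-effective = firing-of-difference {D} {E} σ E≥0 fired≥0

    flat : ∀ c → σ (ee e c) ≡ σ (vb (endpoint G e c))
    flat c = flat-across-heavy D D≥0 degD<M σ (Lap≤-of-firing σ E≥0 fired≥0) (heavy-ee-vb e c)

    Lap-x : Lap G r σ x ≡ + r * (σ x - σ y)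
    Lap-x = Lap-edgeVertex σ e b (flat b)

    Lap-y : Lap G r σ y ≡ + r * (σ y - σ x)
    Lap-y = trans (Lap-edgeVertex σ e (not b) (flat (not b)))
                  (cong (λ c → + r * (σ y - σ (ee e c))) (not-involutive b))

    rk≥1 : 1ℤ ≤ + r * (σ y - σ x)
    rk≥1 = ℤP.0≤i-j⇒j≤i (subst (0ℤ ≤_) balance (fired≥0 x))
      where
      identity : ∀ a R s t → (a - (1ℤ + a)) - R * (s - t) ≡ R * (t - s) - 1ℤ
      identity = solve-∀
      balance : (D x - E x) - Lap G r σ x ≡ + r * (σ y - σ x) - 1ℤ
      balance = trans (cong₂ (λ u v → (D x - u) - v) E-x Lap-x) (identity (D x) (+ r) (σ x) (σ y))

    rise : 1ℤ ≤ σ y - σ x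
    rise = ℤP.i<j⇒suc[i]≤j (ℤP.*-cancelˡ-<-nonNeg (+ r)
             (subst (_< + r * (σ y - σ x)) (sym (ℤP.*-zeroʳ (+ r))) (ℤP.suc[i]≤j⇒i<j rk≥1)))

    σ-separates : σ (vb (endpoint G e b)) ≢ σ (vb (endpoint G e (not b)))
    σ-separates same = 1≰0 (subst (1ℤ ≤_) no-rise rise)
      where
      no-rise : σ y - σ x ≡ 0ℤ
      no-rise = trans (cong₂ _-_ (trans (flat (not b)) (sym same)) (flat b)) (ℤP.+-inverseʳ (σ (vb (endpoint G e b))))
      1≰0 : ¬ 1ℤ ≤ 0ℤ
      1≰0 (+≤+ ())

    degree-bound : + (2 ℕ.* r) - 1ℤ ≤ D x + D y
    degree-bound = ℤP.0≤i-j⇒j≤i (subst (0ℤ ≤_) balance (ℤP.+-mono-≤ (fired≥0 y) rk≥r))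
      where
      rk≥r : 0ℤ ≤ + r * (σ y - σ x) - + r
      rk≥r = ℤP.i≤j⇒0≤j-i (subst (_≤ + r * (σ y - σ x)) (ℤP.*-identityʳ (+ r)) (ℤP.*-monoˡ-≤-nonNeg (+ r) rise))
      identity : ∀ a d R k → ((d - (R - (1ℤ + a))) - R * k) + (R * k - R) ≡ (a + d) - ((R + R) - 1ℤ)
      identity = solve-∀
      balance : ((D y - E y) - Lap G r σ y) + (+ r * (σ y - σ x) - + r) ≡ (D x + D y) - (+ (2 ℕ.* r) - 1ℤ)
      balance = trans (cong₂ (λ u v → ((D y - u) - v) + (+ r * (σ y - σ x) - + r)) E-y Lap-y)
                (trans (identity (D x) (D y) (+ r) (σ y - σ x))
                       (cong (λ t → (D x + D y) - (t - 1ℤ)) (sym (+[2*r]≡r+r r))))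

lemma3p6 : (G : Graph) → NoLoops G → Connected G → (r : ℕ) → 1 ℕ.≤ r →
    (D : Divisor G) → Effective D → HasRank G r D r → IsDgon G r D →
    (e : Fin (m G)) →
      (SimD G r D (vb (endpoint G e false)) (vb (endpoint G e true)) →
        + (2 ℕ.* r) ≤ (D (ee e false) + D (ee e true)))
      ×
      (¬ SimD G r D (vb (endpoint G e false)) (vb (endpoint G e true)) →
        (+ (2 ℕ.* r) - 1ℤ) ≤ (D (ee e false) + D (ee e true)))
lemma3p6 G _ _ r _ D D≥0 (rank≥r , _) dgon e
  with D (ee e false) ℤP.<? + r | D (ee e true) ℤP.<? + r
... | yes short | _ =
  (λ sim → ⊥-elim (σ-separates (sim σ σ-effective))) , (λ _ → degree-bound)
  where open ShortEdge G r D D≥0 (dgon<bigM G r D dgon) rank≥r e false short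
... | no _ | yes short =
  (λ sim → ⊥-elim (σ-separates (sym (sim σ σ-effective)))) ,
  (λ _ → subst (_ ≤_) (ℤP.+-comm (D (ee e true)) (D (ee e false))) degree-bound)
  where open ShortEdge G r D D≥0 (dgon<bigM G r D dgon) rank≥r e true short
... | no long₀ | no long₁ =
  (λ _ → both-long) , (λ _ → ℤP.≤-trans (ℤP.i-j≤i (+ (2 ℕ.* r)) 1ℤ) both-long)
  where
  both-long : + (2 ℕ.* r) ≤ D (ee e false) + D (ee e true)
  both-long = subst (_≤ D (ee e false) + D (ee e true)) (sym (+[2*r]≡r+r r))
                    (ℤP.+-mono-≤ (ℤP.≮⇒≥ long₀) (ℤP.≮⇒≥ long₁))
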